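{- Let $m\ge 2$, $k\ge 1$, $x\in kP_m\cap L_m$, $v\in V_m$ and $A=(a_1,\dots,a_m)\in\{0,1,2\}^m$. Put $D_i(A)=S_i(x,A)-S_i(x-v,A)$ for $i=1,2$. Then: (1) If $a_1+\dots+a_m=5$ and $a_m=2$, then $D_1(A)\in\{2,5\}$. (2) If $a_1+\dots+a_m=2$, then $D_1(A)\in\{2,5\}$. Moreover, if $v=v(0)$ or $a_m=2$, then $D_1(A)=2$; and if $a_m=1$, $a_j=1$ and $v=v(m,j)$, then also $D_1(A)=2$. (3) If $a_1+\dots+a_m=2$, then $D_2(A)\in\{2,5\}$. Moreover, if $v=v(0)$ or $a_m=2$, then $D_2(A)=2$; and if $a_m=1$ and $v=v(m,j)$ for some $j$, then also $D_2(A)=2$.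
   Context: $P_m\subseteq\mathbb{R}^{3m}$ with coordinates $x_g^j$, $g\in\mathbb{Z}_3=\{0,1,2\}$, $1\le j\le m$; $x(g_1,\dots,g_m)$ has $x_g^j=1$ if $g=g_j$ and $0$ otherwise; $P_m=\operatorname{conv}\{x(g_1,\dots,g_m):\sum g_j=0\in\mathbb{Z}_3\}$, and $L_m$ is the lattice generated by its vertices. $v(0)=x(0,\dots,0)$; for $j_1\neq j_2$, $v(j_1,j_2)=x(g_1,\dots,g_m)$ with $g_{j_1}=1$, $g_{j_2}=2$ and $g_j=0$ otherwise. $V_m=\{v(0),v(j,m),v(m,j):1\le j\le m-1\}$. Write $x^j=(x_0^j,x_1^j,x_2^j)$, $u_0=(0,1,2)$, $u_1=(1,2,0)$, $u_2=(2,0,1)$, $w_0=(0,2,1)$, $w_1=(1,0,2)$, $w_2=(2,1,0)$, $S_1(x,A)=\sum_j\langle u_{a_j},x^j\rangle$, $S_2(x,A)=\sum_j\langle w_{a_j},x^j\rangle$. -}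

module Defs where

open import Data.Nat as ℕ using (ℕ; zero; suc)
open import Data.Nat.DivMod using (_%_)
open import Data.Fin as F using (Fin; zero; suc; toℕ; fromℕ; inject₁)
open import Data.Fin.Properties using (_≟_)
open import Data.Integer as ℤ using (ℤ; +_)
open import Data.Rational as ℚ using (ℚ; 0ℚ; 1ℚ)
open import Data.List using (List; []; _∷_)
open import Data.List.Relation.Unary.All using (All)
open import Data.Product using (Σ; _×_; _,_; proj₁; proj₂)
open import Relation.Nullary using (yes; no)
open import Relation.Binary.PropositionalEquality using (_≡_)

-- Z3 = {0,1,2} is Fin 3.  Coordinates j ∈ {1..m} are Fin m (index m = last).
-- A point of R^{3m} with coordinates x^j_g is a function Fin m → Fin 3 → (scalar).

sumℤ : (m : ℕ) → (Fin m → ℤ) → ℤ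
sumℤ zero    f = + 0
sumℤ (suc m) f = f zero ℤ.+ sumℤ m (λ i → f (suc i))

sumℕ : (m : ℕ) → (Fin m → ℕ) → ℕ
sumℕ zero    f = 0
sumℕ (suc m) f = f zero ℕ.+ sumℕ m (λ i → f (suc i))

entrySum : (m : ℕ) → (Fin m → Fin 3) → ℕ
entrySum m a = sumℕ m (λ j → toℕ (a j))

ZeroSum : (m : ℕ) → (Fin m → Fin 3) → Set
ZeroSum m g = entrySum m g % 3 ≡ 0

xpt : {m : ℕ} → (Fin m → Fin 3) → Fin m → Fin 3 → ℤ
xpt g j h with g j ≟ h
... | yes _ = + 1
... | no  _ = + 0

-- v(0) and v(j1,j2) as tuples of group elements
v0 : {m : ℕ} → Fin m → Fin 3
v0 _ = zero

vpair : {m : ℕ} → Fin m → Fin m → (Fin m → Fin 3)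
vpair j1 j2 j with j ≟ j1 | j ≟ j2
... | yes _ | _     = suc zero
... | no _  | yes _ = suc (suc zero)
... | no _  | no _  = zero

-- V_m for m = suc n : {v(0)} ∪ {v(j,m), v(m,j) : 1 ≤ j ≤ m-1}
-- (j ranges over Fin n, embedded by inject₁; m is fromℕ n)
data InV (n : ℕ) : (Fin (suc n) → Fin 3) → Set where
  isv0  : InV n v0
  isvjm : (j : Fin n) → InV n (vpair (inject₁ j) (fromℕ n))
  isvmj : (j : Fin n) → InV n (vpair (fromℕ n) (inject₁ j))

-- x ∈ L_m : x is a (finite) integer combination of vertices of P_m
InL : (m : ℕ) → (Fin m → Fin 3 → ℤ) → Set
InL m x = Σ (List (ℤ × (Fin m → Fin 3))) λ cs →
  All (λ p → ZeroSum m (proj₂ p)) cs ×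
  (∀ j h → x j h ≡ combℤ cs j h)
  where
  combℤ : List (ℤ × (Fin m → Fin 3)) → Fin m → Fin 3 → ℤ
  combℤ []             j h = + 0
  combℤ ((c , g) ∷ cs) j h = c ℤ.* xpt g j h ℤ.+ combℤ cs j h

toℚ : ℤ → ℚ
toℚ z = z ℚ./ 1

-- x ∈ k P_m : x = k y with y a convex combination of vertices of P_m
-- (rational coefficients suffice, since P_m has rational vertices and x is integral)
InkP : (m : ℕ) → ℕ → (Fin m → Fin 3 → ℤ) → Set
InkP m k x = Σ (List (ℚ × (Fin m → Fin 3))) λ cs →
  All (λ p → (0ℚ ℚ.≤ proj₁ p) × ZeroSum m (proj₂ p)) cs ×
  (weightSum cs ≡ 1ℚ) ×
  (∀ j h → toℚ (x j h) ≡ toℚ (+ k) ℚ.* combℚ cs j h)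
  where
  weightSum : List (ℚ × (Fin m → Fin 3)) → ℚ
  weightSum []             = 0ℚ
  weightSum ((c , g) ∷ cs) = c ℚ.+ weightSum cs
  combℚ : List (ℚ × (Fin m → Fin 3)) → Fin m → Fin 3 → ℚ
  combℚ []             j h = 0ℚ
  combℚ ((c , g) ∷ cs) j h = c ℚ.* toℚ (xpt g j h) ℚ.+ combℚ cs j h

u : Fin 3 → Fin 3 → ℤ
u zero             = λ { zero → + 0 ; (suc zero) → + 1 ; (suc (suc zero)) → + 2 }
u (suc zero)       = λ { zero → + 1 ; (suc zero) → + 2 ; (suc (suc zero)) → + 0 }
u (suc (suc zero)) = λ { zero → + 2 ; (suc zero) → + 0 ; (suc (suc zero)) → + 1 }

w : Fin 3 → Fin 3 → ℤ
w zero             = λ { zero → + 0 ; (suc zero) → + 2 ; (suc (suc zero)) → + 1 }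
w (suc zero)       = λ { zero → + 1 ; (suc zero) → + 0 ; (suc (suc zero)) → + 2 }
w (suc (suc zero)) = λ { zero → + 2 ; (suc zero) → + 1 ; (suc (suc zero)) → + 0 }

inner3 : (Fin 3 → ℤ) → (Fin 3 → ℤ) → ℤ
inner3 p q = p zero ℤ.* q zero ℤ.+ (p (suc zero) ℤ.* q (suc zero) ℤ.+ p (suc (suc zero)) ℤ.* q (suc (suc zero)))

S₁ : (m : ℕ) → (Fin m → Fin 3 → ℤ) → (Fin m → Fin 3) → ℤ
S₁ m x a = sumℤ m (λ j → inner3 (u (a j)) (x j))

S₂ : (m : ℕ) → (Fin m → Fin 3 → ℤ) → (Fin m → Fin 3) → ℤ
S₂ m x a = sumℤ m (λ j → inner3 (w (a j)) (x j))

_minusV_ : {m : ℕ} → (Fin m → Fin 3 → ℤ) → (Fin m → Fin 3) → Fin m → Fin 3 → ℤ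
(x minusV g) j h = x j h ℤ.- xpt g j h

D₁ D₂ : (m : ℕ) → (Fin m → Fin 3 → ℤ) → (Fin m → Fin 3) → (Fin m → Fin 3) → ℤ
D₁ m x v a = S₁ m x a ℤ.- S₁ m (x minusV v) a
D₂ m x v a = S₂ m x a ℤ.- S₂ m (x minusV v) a

In25 : ℤ → Set
In25 z = (z ≡ + 2) ⊎' (z ≡ + 5)
  where open import Data.Sum using () renaming (_⊎_ to _⊎'_)

{-# OPTIONS --safe #-}
-- Since S_i is linear in x, D_i(A) = S_i(v, A) only depends on the vertex v. As u_a(g) = a + g and w_a(g) = a − g mod 3, D_i(A) is Σ a_j for
-- v = v(0), and for v = v(p, q) it is Σ a_j with a_p, a_q replaced by a_p ± 1, a_q ± 2 mod 3.
-- The claims then follow by checking the nine pairs (a_p, a_q), where a_p + a_q ≤ Σ a_j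
-- rules out the pairs that would give other values.
module Submission where

open import Defs
open import Data.Nat using (ℕ; suc; _≤_)
open import Data.Fin using (Fin; zero; suc; fromℕ; inject₁)
open import Data.Integer using (ℤ; +_)
open import Data.Product using (_×_)
open import Data.Sum using (_⊎_)
open import Relation.Binary.PropositionalEquality using (_≡_)

open import Function using (_∘_)
open import Data.Nat as ℕ using (_+_)
open import Data.Nat.DivMod using (_%_)
import Data.Nat.Properties as ℕ
open import Data.Fin using (toℕ)
open import Data.Fin.Patterns using (0F; 1F; 2F)
open import Data.Fin.Properties using (_≟_; suc-injective; fromℕ≢inject₁)
open import Data.Integer as ℤ using ()
import Data.Integer.Properties as ℤ
open import Data.Integer.Tactic.RingSolver using (solve-∀)
open import Data.Product using (_,_; proj₂)
open import Data.Sum using (inj₁; inj₂; [_,_])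
open import Data.Empty using (⊥-elim)
open import Relation.Nullary using (yes; no)
open import Relation.Binary.PropositionalEquality
  using (_≢_; refl; sym; trans; cong; cong₂; module ≡-Reasoning)
open import Algebra.Properties.CommutativeSemigroup ℕ.+-commutativeSemigroup
  using (x∙yz≈y∙xz; interchange)

sumℤ-cong : ∀ m {f g : Fin m → ℤ} → (∀ j → f j ≡ g j) → sumℤ m f ≡ sumℤ m g
sumℤ-cong ℕ.zero    f≗g = refl
sumℤ-cong (ℕ.suc m) f≗g = cong₂ ℤ._+_ (f≗g zero) (sumℤ-cong m (f≗g ∘ suc))

sumℕ-cong : ∀ m {f g : Fin m → ℕ} → (∀ j → f j ≡ g j) → sumℕ m f ≡ sumℕ m g
sumℕ-cong ℕ.zero    f≗g = refl
sumℕ-cong (ℕ.suc m) f≗g = cong₂ _+_ (f≗g zero) (sumℕ-cong m (f≗g ∘ suc))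

sumℤ-− : ∀ m (f g : Fin m → ℤ) → sumℤ m f ℤ.- sumℤ m g ≡ sumℤ m (λ j → f j ℤ.- g j)
sumℤ-− ℕ.zero    f g = refl
sumℤ-− (ℕ.suc m) f g =
  trans (regroup (f zero) (g zero) _ _) (cong (ℤ._+_ (f zero ℤ.- g zero)) (sumℤ-− m (f ∘ suc) (g ∘ suc)))
  where
  regroup : ∀ a b c d → (a ℤ.+ c) ℤ.- (b ℤ.+ d) ≡ (a ℤ.- b) ℤ.+ (c ℤ.- d)
  regroup = solve-∀

sumℤ-+ : ∀ m (f : Fin m → ℕ) → sumℤ m (λ j → + f j) ≡ + sumℕ m f
sumℤ-+ ℕ.zero    f = refl
sumℤ-+ (ℕ.suc m) f = cong (ℤ._+_ (+ f zero)) (sumℤ-+ m (f ∘ suc))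

sumℕ-exchange : ∀ m (f g : Fin m → ℕ) q → (∀ j → j ≢ q → f j ≡ g j) →
  g q + sumℕ m f ≡ f q + sumℕ m g
sumℕ-exchange (ℕ.suc m) f g zero    f≗g =
  trans (x∙yz≈y∙xz (g zero) (f zero) _)
        (cong (λ t → f zero + (g zero + t)) (sumℕ-cong m (λ j → f≗g (suc j) λ ())))
sumℕ-exchange (ℕ.suc m) f g (suc q) f≗g = begin
  g (suc q) + (f zero + sumℕ m (f ∘ suc))  ≡⟨ x∙yz≈y∙xz (g (suc q)) (f zero) _ ⟩
  f zero + (g (suc q) + sumℕ m (f ∘ suc))  ≡⟨ cong₂ _+_ (f≗g zero λ ()) tail ⟩
  g zero + (f (suc q) + sumℕ m (g ∘ suc))  ≡⟨ x∙yz≈y∙xz (g zero) (f (suc q)) _ ⟩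
  f (suc q) + (g zero + sumℕ m (g ∘ suc))  ∎
  where
  open ≡-Reasoning
  tail : g (suc q) + sumℕ m (f ∘ suc) ≡ f (suc q) + sumℕ m (g ∘ suc)
  tail = sumℕ-exchange m (f ∘ suc) (g ∘ suc) q (λ j j≢q → f≗g (suc j) (j≢q ∘ suc-injective))

sumℕ-exchange₂ : ∀ m (f g : Fin m → ℕ) p q → p ≢ q → (∀ j → j ≢ p → j ≢ q → f j ≡ g j) →
  (g p + g q) + sumℕ m f ≡ (f p + f q) + sumℕ m g
sumℕ-exchange₂ (ℕ.suc m) f g zero    zero    p≢q f≗g = ⊥-elim (p≢q refl)
sumℕ-exchange₂ (ℕ.suc m) f g zero    (suc q) p≢q f≗g = begin
  (g zero + g (suc q)) + (f zero + sumℕ m (f ∘ suc))  ≡⟨ interchange (g zero) _ _ _ ⟩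
  (g zero + f zero) + (g (suc q) + sumℕ m (f ∘ suc))  ≡⟨ cong₂ _+_ (ℕ.+-comm (g zero) _) tail ⟩
  (f zero + g zero) + (f (suc q) + sumℕ m (g ∘ suc))  ≡⟨ interchange (f zero) _ _ _ ⟩
  (f zero + f (suc q)) + (g zero + sumℕ m (g ∘ suc))  ∎
  where
  open ≡-Reasoning
  tail : g (suc q) + sumℕ m (f ∘ suc) ≡ f (suc q) + sumℕ m (g ∘ suc)
  tail = sumℕ-exchange m (f ∘ suc) (g ∘ suc) q (λ j j≢q → f≗g (suc j) (λ ()) (j≢q ∘ suc-injective))
sumℕ-exchange₂ (ℕ.suc m) f g (suc p) zero    p≢q f≗g =
  trans (cong (_+ sumℕ (ℕ.suc m) f) (ℕ.+-comm (g (suc p)) (g zero)))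
  (trans (sumℕ-exchange₂ (ℕ.suc m) f g zero (suc p) (p≢q ∘ sym) (λ j j≢0 j≢p → f≗g j j≢p j≢0))
         (cong (_+ sumℕ (ℕ.suc m) g) (ℕ.+-comm (f zero) (f (suc p)))))
sumℕ-exchange₂ (ℕ.suc m) f g (suc p) (suc q) p≢q f≗g = begin
  (g (suc p) + g (suc q)) + (f zero + sumℕ m (f ∘ suc))  ≡⟨ x∙yz≈y∙xz (g (suc p) + g (suc q)) (f zero) _ ⟩
  f zero + ((g (suc p) + g (suc q)) + sumℕ m (f ∘ suc))  ≡⟨ cong₂ _+_ (f≗g zero (λ ()) (λ ())) tail ⟩
  g zero + ((f (suc p) + f (suc q)) + sumℕ m (g ∘ suc))  ≡⟨ x∙yz≈y∙xz (g zero) (f (suc p) + f (suc q)) _ ⟩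
  (f (suc p) + f (suc q)) + (g zero + sumℕ m (g ∘ suc))  ∎
  where
  open ≡-Reasoning
  tail : (g (suc p) + g (suc q)) + sumℕ m (f ∘ suc) ≡ (f (suc p) + f (suc q)) + sumℕ m (g ∘ suc)
  tail = sumℕ-exchange₂ m (f ∘ suc) (g ∘ suc) p q (p≢q ∘ cong suc)
           (λ j j≢p j≢q → f≗g (suc j) (j≢p ∘ suc-injective) (j≢q ∘ suc-injective))

basis : Fin 3 → Fin 3 → ℤ
basis b h with b ≟ h
... | yes _ = + 1
... | no  _ = + 0

xpt≡basis : ∀ {m} (g : Fin m → Fin 3) j h → xpt g j h ≡ basis (g j) h
xpt≡basis g j h with g j ≟ h
... | yes _ = refl
... | no  _ = refl

inner3-congʳ : ∀ p {q r : Fin 3 → ℤ} → (∀ h → q h ≡ r h) → inner3 p q ≡ inner3 p r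
inner3-congʳ p q≗r =
  cong₂ ℤ._+_ (cong (ℤ._*_ (p 0F)) (q≗r 0F))
    (cong₂ ℤ._+_ (cong (ℤ._*_ (p 1F)) (q≗r 1F)) (cong (ℤ._*_ (p 2F)) (q≗r 2F)))

inner3-basis : ∀ p b → inner3 p (basis b) ≡ p b
inner3-basis p 0F =
  trans (cong₂ ℤ._+_ (ℤ.*-identityʳ (p 0F)) (cong₂ ℤ._+_ (ℤ.*-zeroʳ (p 1F)) (ℤ.*-zeroʳ (p 2F))))
        (ℤ.+-identityʳ (p 0F))
inner3-basis p 1F =
  trans (cong₂ ℤ._+_ (ℤ.*-zeroʳ (p 0F)) (cong₂ ℤ._+_ (ℤ.*-identityʳ (p 1F)) (ℤ.*-zeroʳ (p 2F))))
        (trans (ℤ.+-identityˡ _) (ℤ.+-identityʳ (p 1F)))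
inner3-basis p 2F =
  trans (cong₂ ℤ._+_ (ℤ.*-zeroʳ (p 0F)) (cong₂ ℤ._+_ (ℤ.*-zeroʳ (p 1F)) (ℤ.*-identityʳ (p 2F))))
        (trans (ℤ.+-identityˡ _) (ℤ.+-identityˡ (p 2F)))

inner3-xpt : ∀ {m} p (g : Fin m → Fin 3) j → inner3 p (xpt g j) ≡ p (g j)
inner3-xpt p g j = trans (inner3-congʳ p (xpt≡basis g j)) (inner3-basis p (g j))

inner3-− : ∀ p (q r : Fin 3 → ℤ) → inner3 p q ℤ.- inner3 p (λ h → q h ℤ.- r h) ≡ inner3 p r
inner3-− p q r = bilinear (p 0F) (p 1F) (p 2F) (q 0F) (q 1F) (q 2F) (r 0F) (r 1F) (r 2F)
  where
  bilinear : ∀ p₀ p₁ p₂ q₀ q₁ q₂ r₀ r₁ r₂ →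
    (p₀ ℤ.* q₀ ℤ.+ (p₁ ℤ.* q₁ ℤ.+ p₂ ℤ.* q₂))
      ℤ.- (p₀ ℤ.* (q₀ ℤ.- r₀) ℤ.+ (p₁ ℤ.* (q₁ ℤ.- r₁) ℤ.+ p₂ ℤ.* (q₂ ℤ.- r₂)))
      ≡ p₀ ℤ.* r₀ ℤ.+ (p₁ ℤ.* r₁ ℤ.+ p₂ ℤ.* r₂)
  bilinear = solve-∀

sum-inner3-minusV : ∀ m (U : Fin 3 → Fin 3 → ℤ) x (g a : Fin m → Fin 3) →
  sumℤ m (λ j → inner3 (U (a j)) (x j)) ℤ.- sumℤ m (λ j → inner3 (U (a j)) ((x minusV g) j))
    ≡ sumℤ m (λ j → U (a j) (g j))
sum-inner3-minusV m U x g a =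
  trans (sumℤ-− m _ _)
        (sumℤ-cong m (λ j → trans (inner3-− (U (a j)) (x j) (xpt g j)) (inner3-xpt (U (a j)) g j)))

-- 2g stands for −g, keeping wℕ in ℕ.
uℕ wℕ : Fin 3 → Fin 3 → ℕ
uℕ a g = (toℕ a + toℕ g) % 3
wℕ a g = (toℕ a + 2 ℕ.* toℕ g) % 3

u≡uℕ : ∀ a g → u a g ≡ + uℕ a g
u≡uℕ 0F 0F = refl
u≡uℕ 0F 1F = refl
u≡uℕ 0F 2F = refl
u≡uℕ 1F 0F = refl
u≡uℕ 1F 1F = refl
u≡uℕ 1F 2F = refl
u≡uℕ 2F 0F = refl
u≡uℕ 2F 1F = refl
u≡uℕ 2F 2F = refl

w≡wℕ : ∀ a g → w a g ≡ + wℕ a g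
w≡wℕ 0F 0F = refl
w≡wℕ 0F 1F = refl
w≡wℕ 0F 2F = refl
w≡wℕ 1F 0F = refl
w≡wℕ 1F 1F = refl
w≡wℕ 1F 2F = refl
w≡wℕ 2F 0F = refl
w≡wℕ 2F 1F = refl
w≡wℕ 2F 2F = refl

uℕ-0F : ∀ a → uℕ a 0F ≡ toℕ a
uℕ-0F 0F = refl
uℕ-0F 1F = refl
uℕ-0F 2F = refl

wℕ-0F : ∀ a → wℕ a 0F ≡ toℕ a
wℕ-0F 0F = refl
wℕ-0F 1F = refl
wℕ-0F 2F = refl

D₁-vertex : ∀ {m} x (g a : Fin m → Fin 3) → D₁ m x g a ≡ + sumℕ m (λ j → uℕ (a j) (g j))
D₁-vertex {m} x g a =
  trans (sum-inner3-minusV m u x g a) (trans (sumℤ-cong m (λ j → u≡uℕ (a j) (g j))) (sumℤ-+ m _))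

D₂-vertex : ∀ {m} x (g a : Fin m → Fin 3) → D₂ m x g a ≡ + sumℕ m (λ j → wℕ (a j) (g j))
D₂-vertex {m} x g a =
  trans (sum-inner3-minusV m w x g a) (trans (sumℤ-cong m (λ j → w≡wℕ (a j) (g j))) (sumℤ-+ m _))

vpair-first : ∀ {m} (p q : Fin m) → vpair p q p ≡ 1F
vpair-first p q with p ≟ p
... | yes _   = refl
... | no p≢p = ⊥-elim (p≢p refl)

vpair-second : ∀ {m} {p q : Fin m} → p ≢ q → vpair p q q ≡ 2F
vpair-second {p = p} {q} p≢q with q ≟ p | q ≟ q
... | yes q≡p | _       = ⊥-elim (p≢q (sym q≡p))
... | no _    | yes _   = refl
... | no _    | no q≢q = ⊥-elim (q≢q refl)

vpair-elsewhere : ∀ {m} {p q j : Fin m} → j ≢ p → j ≢ q → vpair p q j ≡ 0F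
vpair-elsewhere {p = p} {q} {j} j≢p j≢q with j ≟ p | j ≟ q
... | yes j≡p | _       = ⊥-elim (j≢p j≡p)
... | no _    | yes j≡q = ⊥-elim (j≢q j≡q)
... | no _    | no _    = refl

module _ (c : Fin 3 → Fin 3 → ℕ) (c-0F : ∀ a → c a 0F ≡ toℕ a) {m} (a : Fin m → Fin 3) where

  v0-sum : sumℕ m (λ j → c (a j) (v0 j)) ≡ entrySum m a
  v0-sum = sumℕ-cong m (λ j → c-0F (a j))

  vpair-sum : ∀ {p q} → p ≢ q →
    (toℕ (a p) + toℕ (a q)) + sumℕ m (λ j → c (a j) (vpair p q j))
      ≡ (c (a p) 1F + c (a q) 2F) + entrySum m a
  vpair-sum {p} {q} p≢q =
    trans (sumℕ-exchange₂ m _ _ p q p≢q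
             (λ j j≢p j≢q → trans (cong (c (a j)) (vpair-elsewhere j≢p j≢q)) (c-0F (a j))))
          (cong (_+ entrySum m a)
             (cong₂ _+_ (cong (c (a p)) (vpair-first p q)) (cong (c (a q)) (vpair-second p≢q))))

-- In the checks below the equation of vpair-sum fixes S for each pair (a_p, a_q); pairs with
-- a_p + a_q too large make it unsolvable in ℕ, which is how Σ a_j ≥ a_p + a_q is used.
D₁-vpair-sum5 : ∀ {m} x (a : Fin m → Fin 3) {p q} → p ≢ q → entrySum m a ≡ 5 →
  a p ≡ 2F ⊎ a q ≡ 2F → In25 (D₁ m x (vpair p q) a)
D₁-vpair-sum5 x a {p} {q} p≢q E≡5 a≡2 rewrite D₁-vertex x (vpair p q) a =
  check a≡2 (trans (vpair-sum uℕ uℕ-0F a p≢q) (cong (_+_ _) E≡5))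
  where
  check : ∀ {ap aq S} → ap ≡ 2F ⊎ aq ≡ 2F →
    (toℕ ap + toℕ aq) + S ≡ (uℕ ap 1F + uℕ aq 2F) + 5 → In25 (+ S)
  check {aq = 0F} (inj₁ refl) refl = inj₂ refl
  check {aq = 1F} (inj₁ refl) refl = inj₁ refl
  check {aq = 2F} (inj₁ refl) refl = inj₁ refl
  check {ap = 0F} (inj₂ refl) refl = inj₂ refl
  check {ap = 1F} (inj₂ refl) refl = inj₂ refl
  check {ap = 2F} (inj₂ refl) refl = inj₁ refl

D₁-vpair-sum2 : ∀ {m} x (a : Fin m → Fin 3) {p q} → p ≢ q → entrySum m a ≡ 2 →
  In25 (D₁ m x (vpair p q) a)
  × (a p ≡ 2F ⊎ a q ≡ 2F → D₁ m x (vpair p q) a ≡ + 2)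
  × (a p ≡ 1F → a q ≡ 1F → D₁ m x (vpair p q) a ≡ + 2)
D₁-vpair-sum2 x a {p} {q} p≢q E≡2 rewrite D₁-vertex x (vpair p q) a =
  check (a p) (a q) (trans (vpair-sum uℕ uℕ-0F a p≢q) (cong (_+_ _) E≡2))
  where
  check : ∀ ap aq {S} → (toℕ ap + toℕ aq) + S ≡ (uℕ ap 1F + uℕ aq 2F) + 2 →
    In25 (+ S) × (ap ≡ 2F ⊎ aq ≡ 2F → + S ≡ + 2) × (ap ≡ 1F → aq ≡ 1F → + S ≡ + 2)
  check 0F 0F refl = inj₂ refl , (λ { (inj₁ ()) ; (inj₂ ()) }) , (λ ())
  check 0F 1F refl = inj₁ refl , (λ _ → refl) , (λ _ _ → refl)
  check 0F 2F refl = inj₁ refl , (λ _ → refl) , (λ _ _ → refl)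
  check 1F 0F refl = inj₂ refl , (λ { (inj₁ ()) ; (inj₂ ()) }) , (λ _ ())
  check 1F 1F refl = inj₁ refl , (λ _ → refl) , (λ _ _ → refl)
  check 1F 2F refl = inj₁ refl , (λ _ → refl) , (λ _ _ → refl)
  check 2F 0F refl = inj₁ refl , (λ _ → refl) , (λ _ _ → refl)
  check 2F 1F ()
  check 2F 2F ()

D₂-vpair-sum2 : ∀ {m} x (a : Fin m → Fin 3) {p q} → p ≢ q → entrySum m a ≡ 2 →
  In25 (D₂ m x (vpair p q) a)
  × (a p ≡ 2F ⊎ a q ≡ 2F → D₂ m x (vpair p q) a ≡ + 2)
  × (a p ≡ 1F → D₂ m x (vpair p q) a ≡ + 2)
D₂-vpair-sum2 x a {p} {q} p≢q E≡2 rewrite D₂-vertex x (vpair p q) a =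
  check (a p) (a q) (trans (vpair-sum wℕ wℕ-0F a p≢q) (cong (_+_ _) E≡2))
  where
  check : ∀ ap aq {S} → (toℕ ap + toℕ aq) + S ≡ (wℕ ap 1F + wℕ aq 2F) + 2 →
    In25 (+ S) × (ap ≡ 2F ⊎ aq ≡ 2F → + S ≡ + 2) × (ap ≡ 1F → + S ≡ + 2)
  check 0F 0F refl = inj₂ refl , (λ { (inj₁ ()) ; (inj₂ ()) }) , (λ ())
  check 0F 1F refl = inj₂ refl , (λ { (inj₁ ()) ; (inj₂ ()) }) , (λ ())
  check 0F 2F refl = inj₁ refl , (λ _ → refl) , (λ _ → refl)
  check 1F 0F refl = inj₁ refl , (λ _ → refl) , (λ _ → refl)
  check 1F 1F refl = inj₁ refl , (λ _ → refl) , (λ _ → refl)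
  check 1F 2F ()
  check 2F 0F refl = inj₁ refl , (λ _ → refl) , (λ _ → refl)
  check 2F 1F refl = inj₁ refl , (λ _ → refl) , (λ _ → refl)
  check 2F 2F ()

D₁-v0 : ∀ {m} x (a : Fin m → Fin 3) {v} → v ≡ v0 → D₁ m x v a ≡ + entrySum m a
D₁-v0 x a refl = trans (D₁-vertex x v0 a) (cong +_ (v0-sum uℕ uℕ-0F a))

D₂-v0 : ∀ {m} x (a : Fin m → Fin 3) {v} → v ≡ v0 → D₂ m x v a ≡ + entrySum m a
D₂-v0 x a refl = trans (D₂-vertex x v0 a) (cong +_ (v0-sum wℕ wℕ-0F a))

inject₁≢fromℕ : ∀ {n} (j : Fin n) → inject₁ j ≢ fromℕ n
inject₁≢fromℕ j = fromℕ≢inject₁ ∘ sym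

D₁-V-sum5 : ∀ {n} x (a : Fin (suc n) → Fin 3) {v} → InV n v →
  entrySum (suc n) a ≡ 5 → a (fromℕ n) ≡ 2F → In25 (D₁ (suc n) x v a)
D₁-V-sum5 x a isv0      E≡5 _    = inj₂ (trans (D₁-v0 x a refl) (cong +_ E≡5))
D₁-V-sum5 x a (isvjm j) E≡5 aM≡2 = D₁-vpair-sum5 x a (inject₁≢fromℕ j) E≡5 (inj₂ aM≡2)
D₁-V-sum5 x a (isvmj j) E≡5 aM≡2 = D₁-vpair-sum5 x a fromℕ≢inject₁ E≡5 (inj₁ aM≡2)

D₁-V-sum2 : ∀ {n} x (a : Fin (suc n) → Fin 3) {v} → InV n v → entrySum (suc n) a ≡ 2 →
  In25 (D₁ (suc n) x v a) × (a (fromℕ n) ≡ 2F → D₁ (suc n) x v a ≡ + 2)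
D₁-V-sum2 {n} x a isv0 E≡2 = inj₁ D≡2 , λ _ → D≡2
  where
  D≡2 : D₁ (suc n) x v0 a ≡ + 2
  D≡2 = trans (D₁-v0 x a refl) (cong +_ E≡2)
D₁-V-sum2 x a (isvjm j) E≡2 =
  let (D∈25 , D≡2 , _) = D₁-vpair-sum2 x a (inject₁≢fromℕ j) E≡2 in D∈25 , D≡2 ∘ inj₂
D₁-V-sum2 x a (isvmj j) E≡2 =
  let (D∈25 , D≡2 , _) = D₁-vpair-sum2 x a fromℕ≢inject₁ E≡2 in D∈25 , D≡2 ∘ inj₁

D₂-V-sum2 : ∀ {n} x (a : Fin (suc n) → Fin 3) {v} → InV n v → entrySum (suc n) a ≡ 2 →
  In25 (D₂ (suc n) x v a) × (a (fromℕ n) ≡ 2F → D₂ (suc n) x v a ≡ + 2)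
D₂-V-sum2 {n} x a isv0 E≡2 = inj₁ D≡2 , λ _ → D≡2
  where
  D≡2 : D₂ (suc n) x v0 a ≡ + 2
  D≡2 = trans (D₂-v0 x a refl) (cong +_ E≡2)
D₂-V-sum2 x a (isvjm j) E≡2 =
  let (D∈25 , D≡2 , _) = D₂-vpair-sum2 x a (inject₁≢fromℕ j) E≡2 in D∈25 , D≡2 ∘ inj₂
D₂-V-sum2 x a (isvmj j) E≡2 =
  let (D∈25 , D≡2 , _) = D₂-vpair-sum2 x a fromℕ≢inject₁ E≡2 in D∈25 , D≡2 ∘ inj₁

lemma5p5 : (n : ℕ) → 1 ≤ n → (k : ℕ) → 1 ≤ k →
    (x : Fin (suc n) → Fin 3 → ℤ) → InkP (suc n) k x → InL (suc n) x →
    (v : Fin (suc n) → Fin 3) → InV n v →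
    (a : Fin (suc n) → Fin 3) →
      ((entrySum (suc n) a ≡ 5 → a (fromℕ n) ≡ suc (suc zero) → In25 (D₁ (suc n) x v a))
      × (entrySum (suc n) a ≡ 2 →
          In25 (D₁ (suc n) x v a)
          × ((v ≡ v0 ⊎ a (fromℕ n) ≡ suc (suc zero)) → D₁ (suc n) x v a ≡ + 2)
          × ((j : Fin n) → a (fromℕ n) ≡ suc zero → a (inject₁ j) ≡ suc zero →
               v ≡ vpair (fromℕ n) (inject₁ j) → D₁ (suc n) x v a ≡ + 2))
      × (entrySum (suc n) a ≡ 2 →
          In25 (D₂ (suc n) x v a)
          × ((v ≡ v0 ⊎ a (fromℕ n) ≡ suc (suc zero)) → D₂ (suc n) x v a ≡ + 2)
          × ((j : Fin n) → a (fromℕ n) ≡ suc zero →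
               v ≡ vpair (fromℕ n) (inject₁ j) → D₂ (suc n) x v a ≡ + 2)))
lemma5p5 n _ k _ x _ _ v v∈V a =
    D₁-V-sum5 x a v∈V
  , (λ E≡2 →
      let (D∈25 , last≡2⇒D≡2) = D₁-V-sum2 x a v∈V E≡2 in
        D∈25
      , [ (λ v≡v0 → trans (D₁-v0 x a v≡v0) (cong +_ E≡2)) , last≡2⇒D≡2 ]
      , λ { j aM≡1 aj≡1 refl → proj₂ (proj₂ (D₁-vpair-sum2 x a fromℕ≢inject₁ E≡2)) aM≡1 aj≡1 })
  , (λ E≡2 →
      let (D∈25 , last≡2⇒D≡2) = D₂-V-sum2 x a v∈V E≡2 in
        D∈25
      , [ (λ v≡v0 → trans (D₂-v0 x a v≡v0) (cong +_ E≡2)) , last≡2⇒D≡2 ]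
      , λ { j aM≡1 refl → proj₂ (proj₂ (D₂-vpair-sum2 x a fromℕ≢inject₁ E≡2)) aM≡1 })
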